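{- Let $G$ be a finite connected graph, $r\in V(G)$, and $w=\mathds{1}_{\{r\}}$. Then $w^*(v)=\frac{1}{d_G(r,v)+1}$ for all $v\in V(G)$.
   Context: $\mathds{1}_{\{r\}}$ is the function $V(G)\to\mathbb{R}_{\ge0}$ with value $1$ at $r$ and $0$ elsewhere; $d_G$ is the shortest-path distance. For a weight distribution $w\in\mathbb{R}_{\geq0}^{V(G)}$, an edge-sharing move on an edge $xy$ replaces both $w(x)$ and $w(y)$ by $(w(x)+w(y))/2$ and leaves other values unchanged; $w'$ is edge-reachable from $w$ if some finite sequence of edge-sharing moves changes $w$ into $w'$; and $w^*(x)=\sup\{w'(x)\mid w'\text{ edge-reachable from }w\}$. -}

module Defs where

open import Data.Nat using (ℕ; zero; suc; _≤_)
open import Data.Fin using (Fin; _≟_)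
open import Data.Bool using (Bool; true; false)
open import Data.Integer using (+_)
open import Data.Rational using (ℚ; 0ℚ; 1ℚ; _+_; _*_; ½; _/_)
open import Data.Product using (∃; _×_)
open import Relation.Nullary using (yes; no; ¬_)
open import Relation.Binary.PropositionalEquality using (_≡_)

record Graph (n : ℕ) : Set where
  field
    Adj   : Fin n → Fin n → Bool
    sym   : ∀ x y → Adj x y ≡ Adj y x
    irref : ∀ x → Adj x x ≡ false
open Graph public

data Walk {n : ℕ} (G : Graph n) : Fin n → Fin n → ℕ → Set where
  here : ∀ {x} → Walk G x x zero
  step : ∀ {x y z k} → Adj G x y ≡ true → Walk G y z k → Walk G x z (suc k)

Connected : ∀ {n} → Graph n → Set
Connected G = ∀ x y → ∃ λ k → Walk G x y k

IsDistance : ∀ {n} → Graph n → Fin n → Fin n → ℕ → Set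
IsDistance G x y d = Walk G x y d × (∀ k → Walk G x y k → d ≤ k)

-- Weight distributions (values are rational; starting from an indicator
-- every reachable distribution is dyadic rational).
Weight : ℕ → Set
Weight n = Fin n → ℚ

indicator : ∀ {n} → Fin n → Weight n
indicator r z with z ≟ r
... | yes _ = 1ℚ
... | no  _ = 0ℚ

share : ∀ {n} → Weight n → Fin n → Fin n → Weight n
share w x y z with z ≟ x | z ≟ y
... | yes _ | _     = (w x + w y) * ½
... | no _  | yes _ = (w x + w y) * ½
... | no _  | no _  = w z

data Reachable {n : ℕ} (G : Graph n) (w : Weight n) : Weight n → Set where
  start : Reachable G w w
  move  : ∀ {w'} x y → Adj G x y ≡ true → Reachable G w w' → Reachable G w (share w' x y)

inv-suc : ℕ → ℚ
inv-suc d = + 1 / suc d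

{-# OPTIONS --safe #-}
module Submission where

-- Put p x = 1 / (min(d, d(r,x)) + 1) and q x = 1 - p x.  For every vertex set S,
--   Σ_{x ∈ S} w x + Π_{x ∈ S} q x ≤ 1.
-- This holds for w = 1_{r} because q r = 0, and an edge-sharing move on ab preserves it: if
-- a ∈ S and b ∉ S, the left side for the new weights is the average of the left sides at
-- S ∖ {a} and S ∪ {b}, minus ½ Π_{S ∖ {a}} q · (p a (1 + p b) − p b), which is nonnegative
-- because |d(r,a) − d(r,b)| ≤ 1.  Taking S = {v} gives w v ≤ p v = 1 / (d + 1).
--
-- Along a shortest walk r = x₀, …, x_d = v, share across walk edges whose
-- weights differ by at least δ.  Each such move lowers the energy Σ w² by at least δ²/2, so
-- after finitely many moves every weight on the walk is at most w v + d δ.  The weights still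
-- sum to 1 over the d + 1 positions of the walk, hence w v ≥ 1 / (d + 1) − d δ > 1 / (d + 1) − ε
-- for δ = ε / (d + 1).

open import Defs
open import Data.Nat using (ℕ)
open import Data.Fin using (Fin)
open import Data.Rational using (ℚ; 0ℚ; _≤_; _<_; _-_)
open import Data.Product using (∃; _×_)

open import Algebra.Bundles using (CommutativeMonoid; Ring)
open import Data.Bool using (Bool; true; false; if_then_else_; _∨_)
import Data.Bool.Properties as Bool
open import Data.Empty using (⊥; ⊥-elim)
open import Function using (_∘_)
open import Data.Fin using (zero; suc; _≟_; punchIn)
open import Data.Fin.Properties using (punchInᵢ≢i; any?)
open import Data.Integer using (+_; +[1+_])
import Data.Integer as ℤ
import Data.Integer.Properties as ℤ
open import Data.Integer.Tactic.RingSolver using (solve-∀)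
open import Data.Nat using (zero; suc; z≤n; s≤s)
import Data.Nat as ℕ
import Data.Nat.Properties as ℕ
open import Data.Nat.Coprimality using (1-coprimeTo)
open import Data.Product using (_,_; proj₁; proj₂; ∃₂)
open import Data.Rational using (mkℚ; 1ℚ; ½; _+_; _*_; -_; 1/_; *≤*; *<*; nonNegative; nonPositive; positive)
open import Data.Rational.Literals using (fromℤ)
open import Data.Rational.Properties
  hiding (_≟_)
open import Data.Rational.Solver using (module +-*-Solver)
import Data.Rational.Unnormalised as ℚᵘ
import Data.Rational.Unnormalised.Properties as ℚᵘ
open import Data.Sum using (_⊎_; inj₁; inj₂)
open import Data.Vec.Functional using (Vector; removeAt; updateAt)
open import Data.Vec.Functional.Properties using (updateAt-updates; updateAt-minimal)
open import Relation.Binary.PropositionalEquality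
  using (_≡_; _≢_; refl; cong; cong₂; ≡-≟-identity; ≢-≟-identity; module ≡-Reasoning)
import Relation.Binary.PropositionalEquality as ≡
open import Relation.Nullary using (¬_; Dec; yes; no; does)
open import Relation.Nullary.Decidable using (dec-true; _×-dec_; _⊎-dec_)

-- m · x = x + ⋯ + x (m summands); the library's name _×_ for it is taken by the product type.
open import Algebra.Properties.Monoid.Mult +-0-monoid using () renaming (_×_ to _·_)
open import Algebra.Properties.Semiring.Mult (Ring.semiring +-*-ring) using (×-assoc-*; ×-comm-*)
open import Algebra.Properties.Group +-0-group using () renaming (∙-cancelʳ to +-cancelʳ)
open import Algebra.Properties.Semiring.Sum (Ring.semiring +-*-ring) using (*-distribˡ-sum)

0≤½ : 0ℚ ≤ ½
0≤½ = *≤* (ℤ.+≤+ z≤n)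

0≤1 : 0ℚ ≤ 1ℚ
0≤1 = *≤* (ℤ.+≤+ z≤n)

p≤p+q : ∀ {p q} → 0ℚ ≤ q → p ≤ p + q
p≤p+q {p} 0≤q = ≡.subst (_≤ p + _) (+-identityʳ p) (+-monoʳ-≤ p 0≤q)

p≤q+p : ∀ {p q} → 0ℚ ≤ q → p ≤ q + p
p≤q+p {p} {q} 0≤q = ≡.subst (p ≤_) (+-comm p q) (p≤p+q 0≤q)

0≤+ : ∀ {p q} → 0ℚ ≤ p → 0ℚ ≤ q → 0ℚ ≤ p + q
0≤+ = +-mono-≤ {0ℚ} {_} {0ℚ}

*-monoˡ-≤-0≤ : ∀ {r p q} → 0ℚ ≤ r → p ≤ q → r * p ≤ r * q
*-monoˡ-≤-0≤ {r} 0≤r = *-monoˡ-≤-nonNeg r {{nonNegative 0≤r}}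

*-monoʳ-≤-0≤ : ∀ {r p q} → 0ℚ ≤ r → p ≤ q → p * r ≤ q * r
*-monoʳ-≤-0≤ {r} 0≤r = *-monoʳ-≤-nonNeg r {{nonNegative 0≤r}}

0≤* : ∀ {p q} → 0ℚ ≤ p → 0ℚ ≤ q → 0ℚ ≤ p * q
0≤* {p} 0≤p 0≤q = ≡.subst (_≤ p * _) (*-zeroʳ p) (*-monoˡ-≤-0≤ 0≤p 0≤q)

p≤q⇒0≤q-p : ∀ {p q} → p ≤ q → 0ℚ ≤ q - p
p≤q⇒0≤q-p {p} {q} p≤q = ≡.subst (_≤ q - p) (+-inverseʳ p) (+-monoˡ-≤ (- p) p≤q)

≤1-by-average : ∀ {x c y z} → 0ℚ ≤ c → y ≤ 1ℚ → z ≤ 1ℚ → x + c ≡ ½ * (y + z) → x ≤ 1ℚ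
≤1-by-average {x} {c} {y} {z} 0≤c y≤1 z≤1 x+c≡avg = begin
  x             ≤⟨ p≤p+q 0≤c ⟩
  x + c         ≡⟨ x+c≡avg ⟩
  ½ * (y + z)   ≤⟨ *-monoˡ-≤-0≤ 0≤½ (+-mono-≤ y≤1 z≤1) ⟩
  ½ * (1ℚ + 1ℚ) ≡⟨⟩
  1ℚ            ∎
  where open ≤-Reasoning

x+[1-y]≤1⇒x≤y : ∀ {x y} → x + (1ℚ - y) ≤ 1ℚ → x ≤ y
x+[1-y]≤1⇒x≤y {x} {y} h = begin
  x                           ≡⟨ solve 2 (λ x y → x := (x :+ (con 1ℚ :- y)) :+ (y :- con 1ℚ)) refl x y ⟩
  x + (1ℚ - y) + (y - 1ℚ)     ≤⟨ +-monoˡ-≤ (y - 1ℚ) h ⟩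
  1ℚ + (y - 1ℚ)               ≡⟨ solve 1 (λ y → con 1ℚ :+ (y :- con 1ℚ) := y) refl y ⟩
  y                           ∎
  where
  open ≤-Reasoning
  open +-*-Solver

-- Unit fractions

1ℚ+fromℤ : ∀ m → 1ℚ + fromℤ m ≡ fromℤ (+ 1 ℤ.+ m)
1ℚ+fromℤ m = toℚᵘ-injective (ℚᵘ.≃-trans (toℚᵘ-homo-+ 1ℚ (fromℤ m)) (ℚᵘ.*≡* (cross-multiplied m)))
  where
  cross-multiplied : ∀ m → ((+ 1 ℤ.* + 1) ℤ.+ (m ℤ.* + 1)) ℤ.* + 1 ≡ (+ 1 ℤ.+ m) ℤ.* (+ 1 ℤ.* + 1)
  cross-multiplied = solve-∀

·1ℚ≡fromℤ : ∀ m → m · 1ℚ ≡ fromℤ (+ m)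
·1ℚ≡fromℤ zero    = refl
·1ℚ≡fromℤ (suc m) = ≡.trans (cong (_+_ 1ℚ) (·1ℚ≡fromℤ m)) (1ℚ+fromℤ (+ m))

·-*-comm : ∀ m x y → (m · x) * y ≡ x * (m · y)
·-*-comm m x y = ≡.trans (×-assoc-* m x y) (≡.sym (×-comm-* m x y))

·-monoʳ-≤ : ∀ m {x y} → x ≤ y → m · x ≤ m · y
·-monoʳ-≤ zero    x≤y = ≤-refl
·-monoʳ-≤ (suc m) x≤y = +-mono-≤ x≤y (·-monoʳ-≤ m x≤y)

inv-suc≡mkℚ : ∀ k → inv-suc k ≡ mkℚ (+ 1) k (1-coprimeTo (suc k))
inv-suc≡mkℚ k = normalize-coprime (1-coprimeTo (suc k))

suc·inv-suc : ∀ k → suc k · inv-suc k ≡ 1ℚ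
suc·inv-suc k = begin
  suc k · inv-suc k                    ≡⟨ cong (suc k ·_) (≡.sym (*-identityʳ (inv-suc k))) ⟩
  suc k · (inv-suc k * 1ℚ)             ≡⟨ ≡.sym (×-comm-* (suc k) (inv-suc k) 1ℚ) ⟩
  inv-suc k * (suc k · 1ℚ)             ≡⟨ cong₂ _*_ (inv-suc≡mkℚ k) (·1ℚ≡fromℤ (suc k)) ⟩
  1/ fromℤ (+ suc k) * fromℤ (+ suc k) ≡⟨ *-inverseˡ (fromℤ (+ suc k)) ⟩
  1ℚ                                   ∎
  where open ≡-Reasoning

inv-suc-pos : ∀ k → 0ℚ < inv-suc k
inv-suc-pos k rewrite inv-suc≡mkℚ k = *<* (ℤ.+<+ (s≤s z≤n))

inv-suc-≤1 : ∀ k → inv-suc k ≤ 1ℚ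
inv-suc-≤1 k rewrite inv-suc≡mkℚ k = *≤* (ℤ.+≤+ (s≤s z≤n))

inv-suc-antimono : ∀ {j k} → j ℕ.≤ k → inv-suc k ≤ inv-suc j
inv-suc-antimono {j} {k} j≤k rewrite inv-suc≡mkℚ j | inv-suc≡mkℚ k =
  *≤* (ℤ.+≤+ (s≤s (ℕ.+-monoˡ-≤ 0 j≤k)))

inv-suc-suc : ∀ j → inv-suc (suc j) * (1ℚ + inv-suc j) ≡ inv-suc j
inv-suc-suc j = begin
  I′ * (1ℚ + I)           ≡⟨ cong (λ x → I′ * (x + I)) (≡.sym (suc·inv-suc j)) ⟩
  I′ * (suc j · I + I)    ≡⟨ cong (I′ *_) (+-comm (suc j · I) I) ⟩
  I′ * (suc (suc j) · I)  ≡⟨ ≡.sym (·-*-comm (suc (suc j)) I′ I) ⟩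
  (suc (suc j) · I′) * I  ≡⟨ cong (_* I) (suc·inv-suc (suc j)) ⟩
  1ℚ * I                  ≡⟨ *-identityˡ I ⟩
  I                       ∎
  where
  open ≡-Reasoning
  I I′ : ℚ
  I  = inv-suc j
  I′ = inv-suc (suc j)

inv-suc-edge : ∀ {j k} → j ℕ.≤ suc k → inv-suc k ≤ inv-suc j * (1ℚ + inv-suc k)
inv-suc-edge {j} {k} j≤1+k = ≡.subst (_≤ inv-suc j * (1ℚ + inv-suc k)) (inv-suc-suc k)
  (*-monoʳ-≤-0≤ 0≤1+inv-suc-k (inv-suc-antimono j≤1+k))
  where
  0≤1+inv-suc-k : 0ℚ ≤ 1ℚ + inv-suc k
  0≤1+inv-suc-k = 0≤+ {1ℚ} 0≤1 (<⇒≤ (inv-suc-pos k))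

inv-suc-≤ : ∀ k {y} → 1ℚ ≤ suc k · y → inv-suc k ≤ y
inv-suc-≤ k {y} 1≤ = begin
  inv-suc k                ≡⟨ ≡.sym (*-identityʳ (inv-suc k)) ⟩
  inv-suc k * 1ℚ           ≤⟨ *-monoˡ-≤-0≤ (<⇒≤ (inv-suc-pos k)) 1≤ ⟩
  inv-suc k * (suc k · y)  ≡⟨ ≡.sym (·-*-comm (suc k) (inv-suc k) y) ⟩
  (suc k · inv-suc k) * y  ≡⟨ cong (_* y) (suc·inv-suc k) ⟩
  1ℚ * y                   ≡⟨ *-identityˡ y ⟩
  y                        ∎
  where open ≤-Reasoning

archimedean : ∀ {κ} → 0ℚ < κ → ∃ λ N → 1ℚ ≤ N · κ
archimedean {κ@(mkℚ +[1+ p ] q _)} _ =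
  suc q , ≡.subst (_≤ suc q · κ) (suc·inv-suc q) (·-monoʳ-≤ (suc q) inv-suc-q≤κ)
  where
  inv-suc-q≤κ : inv-suc q ≤ κ
  inv-suc-q≤κ rewrite inv-suc≡mkℚ q = *≤* (ℤ.*-monoʳ-≤-nonNeg (+ suc q) (ℤ.+≤+ (s≤s (z≤n {p}))))
archimedean {mkℚ (+ 0) _ _} (*<* (ℤ.+<+ ()))
archimedean {mkℚ ℤ.-[1+ _ ] _ _} (*<* ())

-- Finite sums and products

record Insertion {n} (S : Fin n → Bool) (x : Fin n) (T : Fin n → Bool) : Set where
  field
    absent  : S x ≡ false
    present : T x ≡ true
    agree   : ∀ y → y ≢ x → S y ≡ T y

insertion-add : ∀ {n} {S : Fin n → Bool} {x} → S x ≡ false → Insertion S x (updateAt S x (λ _ → true))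
insertion-add {S = S} {x} Sx≡false = record
  { absent  = Sx≡false
  ; present = updateAt-updates x S
  ; agree   = λ y y≢x → ≡.sym (updateAt-minimal y x S y≢x)
  }

insertion-remove : ∀ {n} {S : Fin n → Bool} {x} → S x ≡ true → Insertion (updateAt S x (λ _ → false)) x S
insertion-remove {S = S} {x} Sx≡true = record
  { absent  = updateAt-updates x S
  ; present = Sx≡true
  ; agree   = λ y y≢x → updateAt-minimal y x S y≢x
  }

member≢nonmember : ∀ {n} {S : Fin n → Bool} {x y} → S x ≡ true → S y ≡ false → x ≢ y
member≢nonmember Sx Sy refl with ≡.trans (≡.sym Sx) Sy
... | ()

module FiniteSum {c ℓ} (M : CommutativeMonoid c ℓ) where

  open CommutativeMonoid M
  open import Algebra.Properties.CommutativeMonoid.Sum M public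
  open import Algebra.Properties.CommutativeSemigroup commutativeSemigroup
  open import Relation.Binary.Reasoning.Setoid setoid

  sum-cong-except : ∀ {n} (f g : Vector Carrier n) i → (∀ j → j ≢ i → f j ≈ g j) →
                    sum f ∙ g i ≈ sum g ∙ f i
  sum-cong-except {suc n} f g i f≈g = begin
    sum f ∙ g i                       ≈⟨ ∙-congʳ (sum-remove f) ⟩
    (f i ∙ sum (removeAt f i)) ∙ g i  ≈⟨ ∙-congʳ (∙-congˡ (sum-cong-≋ rest)) ⟩
    (f i ∙ sum (removeAt g i)) ∙ g i  ≈⟨ xy∙z≈zy∙x _ _ _ ⟩
    (g i ∙ sum (removeAt g i)) ∙ f i  ≈⟨ ∙-congʳ (sum-remove g) ⟨
    sum g ∙ f i                       ∎
    where
    rest : ∀ j → removeAt f i j ≈ removeAt g i j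
    rest j = f≈g (punchIn i j) (punchInᵢ≢i i j)

  sum-cong-except₂ : ∀ {n} (f g : Vector Carrier n) {a b} → a ≢ b →
                     (∀ j → j ≢ a → j ≢ b → f j ≈ g j) →
                     sum f ∙ (g a ∙ g b) ≈ sum g ∙ (f a ∙ f b)
  sum-cong-except₂ f g {a} {b} a≢b f≈g = begin
    sum f ∙ (g a ∙ g b)  ≈⟨ assoc _ _ _ ⟨
    (sum f ∙ g a) ∙ g b  ≡⟨ cong (λ x → (sum f ∙ x) ∙ g b) (≡.sym ha) ⟩
    (sum f ∙ h a) ∙ g b  ≈⟨ ∙-congʳ (sum-cong-except f h a f≈h) ⟩
    (sum h ∙ f a) ∙ g b  ≈⟨ xy∙z≈xz∙y _ _ _ ⟩
    (sum h ∙ g b) ∙ f a  ≈⟨ ∙-congʳ (sum-cong-except h g b h≈g) ⟩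
    (sum g ∙ h b) ∙ f a  ≡⟨ cong (λ x → (sum g ∙ x) ∙ f a) hb ⟩
    (sum g ∙ f b) ∙ f a  ≈⟨ xy∙z≈x∙zy _ _ _ ⟩
    sum g ∙ (f a ∙ f b)  ∎
    where
    h : Vector Carrier _
    h = updateAt f a (λ _ → g a)
    ha : h a ≡ g a
    ha = updateAt-updates a f
    hb : h b ≡ f b
    hb = updateAt-minimal b a f (λ b≡a → a≢b (≡.sym b≡a))
    h≡f : ∀ j → j ≢ a → h j ≡ f j
    h≡f j j≢a = updateAt-minimal j a f j≢a
    f≈h : ∀ j → j ≢ a → f j ≈ h j
    f≈h j j≢a = reflexive (≡.sym (h≡f j j≢a))
    h≈g : ∀ j → j ≢ b → h j ≈ g j
    h≈g j j≢b with j ≟ a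
    ... | yes refl = reflexive ha
    ... | no j≢a   = trans (reflexive (h≡f j j≢a)) (f≈g j j≢a j≢b)

  sum-supported-at : ∀ {n} (f : Vector Carrier n) i → (∀ j → j ≢ i → f j ≈ ε) → sum f ≈ f i
  sum-supported-at {n} f i f≈ε = begin
    sum f                    ≈⟨ identityʳ _ ⟨
    sum f ∙ ε                ≈⟨ sum-cong-except f (λ _ → ε) i f≈ε ⟩
    sum {n} (λ _ → ε) ∙ f i  ≈⟨ ∙-congʳ (sum-replicate-zero n) ⟩
    ε ∙ f i                  ≈⟨ identityˡ _ ⟩
    f i                      ∎

  select : ∀ {n} → (Fin n → Bool) → Vector Carrier n → Vector Carrier n
  select S f i = if S i then f i else ε

  sum-select-insertion : ∀ {n} {S T : Fin n → Bool} {i} → Insertion S i T → ∀ f →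
                         sum (select T f) ≈ sum (select S f) ∙ f i
  sum-select-insertion {S = S} {T} {i} ins f = begin
    sum (select T f)                 ≈⟨ identityʳ _ ⟨
    sum (select T f) ∙ ε             ≡⟨ cong (λ e → sum (select T f) ∙ e) (≡.sym Si≡ε) ⟩
    sum (select T f) ∙ select S f i  ≈⟨ sum-cong-except (select T f) (select S f) i T≈S ⟩
    sum (select S f) ∙ select T f i  ≡⟨ cong (λ e → sum (select S f) ∙ e) Ti≡fi ⟩
    sum (select S f) ∙ f i           ∎
    where
    open Insertion ins
    Si≡ε : select S f i ≡ ε
    Si≡ε rewrite absent = ≡.refl
    Ti≡fi : select T f i ≡ f i
    Ti≡fi rewrite present = ≡.refl
    T≈S : ∀ j → j ≢ i → select T f j ≈ select S f j
    T≈S j j≢i = reflexive (cong (λ β → if β then f j else ε) (≡.sym (agree j j≢i)))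

module Σ = FiniteSum +-0-commutativeMonoid
module Π = FiniteSum *-1-commutativeMonoid

Σ-mono-≤ : ∀ {n} {f g : Vector ℚ n} → (∀ i → f i ≤ g i) → Σ.sum f ≤ Σ.sum g
Σ-mono-≤ {zero}  f≤g = ≤-refl
Σ-mono-≤ {suc n} f≤g = +-mono-≤ (f≤g zero) (Σ-mono-≤ (f≤g ∘ suc))

Σ-cong-pair : ∀ {n} (f g : Vector ℚ n) {a b} → a ≢ b → (∀ j → j ≢ a → j ≢ b → f j ≡ g j) →
              f a + f b ≡ g a + g b → Σ.sum f ≡ Σ.sum g
Σ-cong-pair f g {a} {b} a≢b f≡g pair = +-cancelʳ (f a + f b) (Σ.sum f) (Σ.sum g) (begin
  Σ.sum f + (f a + f b)  ≡⟨ cong (_+_ (Σ.sum f)) pair ⟩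
  Σ.sum f + (g a + g b)  ≡⟨ Σ.sum-cong-except₂ f g a≢b f≡g ⟩
  Σ.sum g + (f a + f b)  ∎)
  where open ≡-Reasoning

Π-∈[0,1] : ∀ {n} {f : Vector ℚ n} → (∀ i → 0ℚ ≤ f i) → (∀ i → f i ≤ 1ℚ) →
           0ℚ ≤ Π.sum f × Π.sum f ≤ 1ℚ
Π-∈[0,1] {zero}      0≤f f≤1 = 0≤1 , ≤-refl
Π-∈[0,1] {suc n} {f} 0≤f f≤1 =
  0≤* (0≤f zero) 0≤Π ,
  ≤-trans (*-monoˡ-≤-0≤ (0≤f zero) Π≤1) (≡.subst (_≤ 1ℚ) (≡.sym (*-identityʳ (f zero))) (f≤1 zero))
  where
  0≤Π : 0ℚ ≤ Π.sum (f ∘ suc)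
  0≤Π = proj₁ (Π-∈[0,1] (0≤f ∘ suc) (f≤1 ∘ suc))
  Π≤1 : Π.sum (f ∘ suc) ≤ 1ℚ
  Π≤1 = proj₂ (Π-∈[0,1] (0≤f ∘ suc) (f≤1 ∘ suc))

record IsShare {n} (w w′ : Weight n) (a b : Fin n) : Set where
  field
    at-left   : w′ a ≡ (w a + w b) * ½
    at-right  : w′ b ≡ (w a + w b) * ½
    elsewhere : ∀ x → x ≢ a → x ≢ b → w′ x ≡ w x

share-isShare : ∀ {n} (w : Weight n) a b → IsShare w (share w a b) a b
share-isShare w a b = record { at-left = at-left ; at-right = at-right ; elsewhere = elsewhere }
  where
  at-left : share w a b a ≡ (w a + w b) * ½
  at-left rewrite ≡-≟-identity _≟_ {a} refl = refl
  at-right : share w a b b ≡ (w a + w b) * ½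
  at-right with b ≟ a
  ... | yes _ = refl
  ... | no _ rewrite ≡-≟-identity _≟_ {b} refl = refl
  elsewhere : ∀ x → x ≢ a → x ≢ b → share w a b x ≡ w x
  elsewhere x x≢a x≢b rewrite ≢-≟-identity _≟_ x≢a | ≢-≟-identity _≟_ x≢b = refl

isShare-sym : ∀ {n} {w w′ : Weight n} {a b} → IsShare w w′ a b → IsShare w w′ b a
isShare-sym {w = w} {a = a} {b} s = record
  { at-left   = ≡.trans at-right (cong (_* ½) (+-comm (w a) (w b)))
  ; at-right  = ≡.trans at-left (cong (_* ½) (+-comm (w a) (w b)))
  ; elsewhere = λ x x≢b x≢a → elsewhere x x≢a x≢b
  }
  where open IsShare s

isShare-pair : ∀ {n} {w w′ : Weight n} {a b} → IsShare w w′ a b → w′ a + w′ b ≡ w a + w b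
isShare-pair {w = w} {w′} {a} {b} s = begin
  w′ a + w′ b                        ≡⟨ cong₂ _+_ at-left at-right ⟩
  (w a + w b) * ½ + (w a + w b) * ½  ≡⟨ solve 1 (λ s → s :* con ½ :+ s :* con ½ := s) refl (w a + w b) ⟩
  w a + w b                          ∎
  where
  open IsShare s
  open ≡-Reasoning
  open +-*-Solver

Σ-share : ∀ {n} {w w′ : Weight n} {a b} → a ≢ b → IsShare w w′ a b → Σ.sum w′ ≡ Σ.sum w
Σ-share a≢b s = Σ-cong-pair _ _ a≢b (IsShare.elsewhere s) (isShare-pair s)

isShare-nonNeg : ∀ {n} {w w′ : Weight n} {a b} → IsShare w w′ a b →
                 (∀ x → 0ℚ ≤ w x) → ∀ x → 0ℚ ≤ w′ x
isShare-nonNeg {w = w} {w′} {a} {b} s 0≤w = 0≤w′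
  where
  open IsShare s
  0≤mean : 0ℚ ≤ (w a + w b) * ½
  0≤mean = 0≤* (0≤+ (0≤w a) (0≤w b)) 0≤½
  0≤w′ : ∀ x → 0ℚ ≤ w′ x
  0≤w′ x with x ≟ a | x ≟ b
  ... | yes refl | _        = ≡.subst (0ℚ ≤_) (≡.sym at-left) 0≤mean
  ... | no _     | yes refl = ≡.subst (0ℚ ≤_) (≡.sym at-right) 0≤mean
  ... | no x≢a   | no x≢b   = ≡.subst (0ℚ ≤_) (≡.sym (elsewhere x x≢a x≢b)) (0≤w x)

adj⇒≢ : ∀ {n} (G : Graph n) {a b} → Adj G a b ≡ true → a ≢ b
adj⇒≢ G {a} Gaa refl with ≡.trans (≡.sym Gaa) (irref G a)
... | ()

indicator-self : ∀ {n} (r : Fin n) → indicator r r ≡ 1ℚ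
indicator-self r rewrite ≡-≟-identity _≟_ {r} refl = refl

indicator-other : ∀ {n} (r : Fin n) {x} → x ≢ r → indicator r x ≡ 0ℚ
indicator-other r x≢r rewrite ≢-≟-identity _≟_ x≢r = refl

indicator-nonNeg : ∀ {n} (r x : Fin n) → 0ℚ ≤ indicator r x
indicator-nonNeg r x with x ≟ r
... | yes _ = 0≤1
... | no _  = ≤-refl

Σ-indicator : ∀ {n} (r : Fin n) → Σ.sum (indicator r) ≡ 1ℚ
Σ-indicator r = ≡.trans (Σ.sum-supported-at (indicator r) r (λ x → indicator-other r)) (indicator-self r)

-- Upper bound

snoc : ∀ {n} {G : Graph n} {x y z k} → Walk G x y k → Adj G y z ≡ true → Walk G x z (suc k)
snoc here         Gyz = step Gyz here
snoc (step Gxx′ W) Gyz = step Gxx′ (snoc W Gyz)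

module BreadthFirstSearch {n} (G : Graph n) (r : Fin n) where

  reached : ℕ → Fin n → Bool
  reached-neighbour? : ∀ k x → Dec (∃ λ y → reached k y ≡ true × Adj G y x ≡ true)

  reached zero    x = does (x ≟ r)
  reached (suc k) x = reached k x ∨ does (reached-neighbour? k x)

  reached-neighbour? k x = any? λ y → (reached k y Bool.≟ true) ×-dec (Adj G y x Bool.≟ true)

  reached-root : ∀ k → reached k r ≡ true
  reached-root zero    rewrite ≡-≟-identity _≟_ {r} refl = refl
  reached-root (suc k) rewrite reached-root k = refl

  reached-edge : ∀ {k x y} → reached k y ≡ true → Adj G y x ≡ true → reached (suc k) x ≡ true
  reached-edge {k} {x} {y} ry Gyx rewrite dec-true (reached-neighbour? k x) (y , ry , Gyx) =
    Bool.∨-zeroʳ (reached k x)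

  reached⇒walk : ∀ k x → reached k x ≡ true → ∃ λ j → j ℕ.≤ k × Walk G r x j
  reached⇒walk zero x rx with x ≟ r
  ... | yes refl = 0 , z≤n , here
  reached⇒walk zero x () | no _
  reached⇒walk (suc k) x rx with reached k x in e | reached-neighbour? k x
  ... | true  | _ with reached⇒walk k x e
  ...   | j , j≤k , W = j , ℕ.m≤n⇒m≤1+n j≤k , W
  reached⇒walk (suc k) x rx | false | yes (y , ry , Gyx) with reached⇒walk k y ry
  ...   | j , j≤k , W = suc j , s≤s j≤k , snoc W Gyx
  reached⇒walk (suc k) x () | false | no _

  -- cappedDistance k x = min k (d(r, x)): the number of rounds i < k after which x is unreached.
  cappedDistance : ℕ → Fin n → ℕ
  cappedDistance zero    x = 0
  cappedDistance (suc k) x = cappedDistance k x ℕ.+ (if reached k x then 0 else 1)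

  cappedDistance-root : ∀ k → cappedDistance k r ≡ 0
  cappedDistance-root zero    = refl
  cappedDistance-root (suc k) rewrite cappedDistance-root k | reached-root k = refl

  cappedDistance-step : ∀ k {x y} → Adj G y x ≡ true → cappedDistance (suc k) x ℕ.≤ suc (cappedDistance k y)
  cappedDistance-step zero    {x} Gyx with reached 0 x
  ... | true  = z≤n
  ... | false = s≤s z≤n
  cappedDistance-step (suc k) {x} {y} Gyx = ℕ.+-mono-≤ (cappedDistance-step k Gyx) round
    where
    round : (if reached (suc k) x then 0 else 1) ℕ.≤ (if reached k y then 0 else 1)
    round with reached (suc k) x in rx | reached k y in ry
    ... | true  | _     = z≤n
    ... | false | false = s≤s z≤n
    ... | false | true  with ≡.trans (≡.sym rx) (reached-edge {k} ry Gyx)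
    ...   | ()

  cappedDistance-edge : ∀ k {x y} → Adj G y x ≡ true → cappedDistance k x ℕ.≤ suc (cappedDistance k y)
  cappedDistance-edge k Gyx = ℕ.≤-trans (ℕ.m≤m+n _ _) (cappedDistance-step k Gyx)

  cappedDistance-unreached : ∀ k {x} → (∀ j → j ℕ.< k → reached j x ≡ false) → cappedDistance k x ≡ k
  cappedDistance-unreached zero    _        = refl
  cappedDistance-unreached (suc k) unreached
    rewrite cappedDistance-unreached k (λ j j<k → unreached j (ℕ.m≤n⇒m≤1+n j<k)) | unreached k ℕ.≤-refl =
    ℕ.+-comm k 1

  cappedDistance-distance : ∀ {v d} → IsDistance G r v d → cappedDistance d v ≡ d
  cappedDistance-distance {v} {d} (_ , shortest) = cappedDistance-unreached d unreached
    where
    unreached : ∀ j → j ℕ.< d → reached j v ≡ false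
    unreached j j<d with reached j v in e
    ... | false = refl
    ... | true with reached⇒walk j v e
    ...   | i , i≤j , W = ⊥-elim (ℕ.<-irrefl refl (ℕ.<-≤-trans j<d (ℕ.≤-trans (shortest i W) i≤j)))

module ShareInvariant {n} (G : Graph n) (p : Weight n)
  (p-nonNeg : ∀ x → 0ℚ ≤ p x) (p-≤1 : ∀ x → p x ≤ 1ℚ)
  (p-edge : ∀ a b → Adj G a b ≡ true → p b ≤ p a * (1ℚ + p b)) where

  q : Weight n
  q x = 1ℚ - p x

  mass : (Fin n → Bool) → Weight n → ℚ
  mass S w = Σ.sum (Σ.select S w)

  escape : (Fin n → Bool) → ℚ
  escape S = Π.sum (Π.select S q)

  Invariant : Weight n → Set
  Invariant w = ∀ S → mass S w + escape S ≤ 1ℚ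

  escape-∈[0,1] : ∀ S → 0ℚ ≤ escape S × escape S ≤ 1ℚ
  escape-∈[0,1] S = Π-∈[0,1] 0≤factor factor≤1
    where
    0≤factor : ∀ x → 0ℚ ≤ Π.select S q x
    0≤factor x with S x
    ... | true  = p≤q⇒0≤q-p (p-≤1 x)
    ... | false = 0≤1
    factor≤1 : ∀ x → Π.select S q x ≤ 1ℚ
    factor≤1 x with S x
    ... | true  = ≡.subst (q x ≤_) (+-identityʳ 1ℚ) (+-monoʳ-≤ 1ℚ (neg-antimono-≤ (p-nonNeg x)))
    ... | false = ≤-refl

  mass-insertion : ∀ {S T x} → Insertion S x T → ∀ w → mass T w ≡ mass S w + w x
  mass-insertion ins = Σ.sum-select-insertion ins

  escape-insertion : ∀ {S T x} → Insertion S x T → escape T ≡ escape S * q x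
  escape-insertion ins = Π.sum-select-insertion ins q

  mass-cong : ∀ S {w w′} → (∀ x → S x ≡ true → w x ≡ w′ x) → mass S w ≡ mass S w′
  mass-cong S {w} {w′} w≡w′ = Σ.sum-cong-≗ pointwise
    where
    pointwise : ∀ x → Σ.select S w x ≡ Σ.select S w′ x
    pointwise x with S x in Sx
    ... | true  = w≡w′ x Sx
    ... | false = refl

  mass-indicator : ∀ S r → mass S (indicator r) ≡ (if S r then 1ℚ else 0ℚ)
  mass-indicator S r = ≡.trans (Σ.sum-supported-at (Σ.select S (indicator r)) r off-r) at-r
    where
    off-r : ∀ x → x ≢ r → Σ.select S (indicator r) x ≡ 0ℚ
    off-r x x≢r rewrite indicator-other r x≢r with S x
    ... | true  = refl
    ... | false = refl
    at-r : Σ.select S (indicator r) r ≡ (if S r then 1ℚ else 0ℚ)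
    at-r rewrite indicator-self r = refl

  escape-vanishes : ∀ {S x} → S x ≡ true → p x ≡ 1ℚ → escape S ≡ 0ℚ
  escape-vanishes {S} {x} Sx px≡1 = begin
    escape S           ≡⟨ escape-insertion (insertion-remove Sx) ⟩
    escape S∖x * q x   ≡⟨ cong (λ y → escape S∖x * (1ℚ - y)) px≡1 ⟩
    escape S∖x * 0ℚ    ≡⟨ *-zeroʳ (escape S∖x) ⟩
    0ℚ                 ∎
    where
    open ≡-Reasoning
    S∖x : Fin n → Bool
    S∖x = updateAt S x (λ _ → false)

  invariant-indicator : ∀ r → p r ≡ 1ℚ → Invariant (indicator r)
  invariant-indicator r pr≡1 S rewrite mass-indicator S r with S r in Sr
  ... | true  = ≤-reflexive (cong (_+_ 1ℚ) (escape-vanishes Sr pr≡1))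
  ... | false = ≡.subst (_≤ 1ℚ) (≡.sym (+-identityˡ (escape S))) (proj₂ (escape-∈[0,1] S))

  mass-same-side : ∀ {w w′ a b} S → a ≢ b → IsShare w w′ a b → S a ≡ S b → mass S w′ ≡ mass S w
  mass-same-side {w} {w′} {a} {b} S a≢b s Sa≡Sb = Σ-cong-pair (Σ.select S w′) (Σ.select S w) a≢b off pair
    where
    off : ∀ x → x ≢ a → x ≢ b → Σ.select S w′ x ≡ Σ.select S w x
    off x x≢a x≢b = cong (λ y → if S x then y else 0ℚ) (IsShare.elsewhere s x x≢a x≢b)
    pair : Σ.select S w′ a + Σ.select S w′ b ≡ Σ.select S w a + Σ.select S w b
    pair rewrite Sa≡Sb with S b
    ... | true  = isShare-pair s
    ... | false = refl

  invariant-across : ∀ {w w′ a b S} → Invariant w → Adj G a b ≡ true → IsShare w w′ a b →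
                     S a ≡ true → S b ≡ false → mass S w′ + escape S ≤ 1ℚ
  invariant-across {w} {w′} {a} {b} {S} inv Gab s Sa Sb =
    ≤1-by-average 0≤slack (inv U) (inv T) average
    where
    T U : Fin n → Bool
    T = updateAt S a (λ _ → false)
    U = updateAt S b (λ _ → true)
    T+a : Insertion T a S
    T+a = insertion-remove Sa
    S+b : Insertion S b U
    S+b = insertion-add Sb
    Tb : T b ≡ false
    Tb = ≡.trans (Insertion.agree T+a b (≡.≢-sym (adj⇒≢ G Gab))) Sb
    w≡w′-on-T : ∀ x → T x ≡ true → w x ≡ w′ x
    w≡w′-on-T x Tx =
      ≡.sym (IsShare.elsewhere s x (member≢nonmember Tx (Insertion.absent T+a)) (member≢nonmember Tx Tb))
    slack : ℚ
    slack = escape T * (p a * (1ℚ + p b) - p b)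
    0≤slack : 0ℚ ≤ ½ * slack
    0≤slack = 0≤* 0≤½ (0≤* (proj₁ (escape-∈[0,1] T)) (p≤q⇒0≤q-p (p-edge a b Gab)))
    mass-S-w′ : mass S w′ ≡ mass T w + (w a + w b) * ½
    mass-S-w′ = ≡.trans (mass-insertion T+a w′) (cong₂ _+_ (≡.sym (mass-cong T w≡w′-on-T)) (IsShare.at-left s))
    mass-U-w : mass U w ≡ (mass T w + w a) + w b
    mass-U-w = ≡.trans (mass-insertion S+b w) (cong (_+ w b) (mass-insertion T+a w))
    escape-S : escape S ≡ escape T * q a
    escape-S = escape-insertion T+a
    escape-U : escape U ≡ (escape T * q a) * q b
    escape-U = ≡.trans (escape-insertion S+b) (cong (_* q b) escape-S)
    average : mass S w′ + escape S + ½ * slack ≡ ½ * ((mass U w + escape U) + (mass T w + escape T))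
    average rewrite mass-S-w′ | escape-S | mass-U-w | escape-U =
      solve 6 (λ m wa wb e pa pb →
          (m :+ (wa :+ wb) :* con ½) :+ e :* (con 1ℚ :- pa) :+ con ½ :* (e :* (pa :* (con 1ℚ :+ pb) :- pb))
        := con ½ :* (((m :+ wa) :+ wb :+ (e :* (con 1ℚ :- pa)) :* (con 1ℚ :- pb)) :+ (m :+ e)))
        refl (mass T w) (w a) (w b) (escape T) (p a) (p b)
      where open +-*-Solver

  invariant-same-side : ∀ {w w′ a b S} → Invariant w → a ≢ b → IsShare w w′ a b →
                        S a ≡ S b → mass S w′ + escape S ≤ 1ℚ
  invariant-same-side {S = S} inv a≢b s Sa≡Sb =
    ≡.subst (λ m → m + escape S ≤ 1ℚ) (≡.sym (mass-same-side S a≢b s Sa≡Sb)) (inv S)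

  invariant-share : ∀ {w a b} → Invariant w → Adj G a b ≡ true → Invariant (share w a b)
  invariant-share {w} {a} {b} inv Gab S with S a in Sa | S b in Sb
  ... | true  | false = invariant-across inv Gab (share-isShare w a b) Sa Sb
  ... | false | true  = invariant-across inv (≡.trans (sym G b a) Gab) (isShare-sym (share-isShare w a b)) Sb Sa
  ... | true  | true  = invariant-same-side inv (adj⇒≢ G Gab) (share-isShare w a b) (≡.trans Sa (≡.sym Sb))
  ... | false | false = invariant-same-side inv (adj⇒≢ G Gab) (share-isShare w a b) (≡.trans Sa (≡.sym Sb))

  invariant-reachable : ∀ {r w} → p r ≡ 1ℚ → Reachable G (indicator r) w → Invariant w
  invariant-reachable pr≡1 start              = invariant-indicator _ pr≡1
  invariant-reachable pr≡1 (move a b Gab reach) = invariant-share (invariant-reachable pr≡1 reach) Gab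

  invariant-bound : ∀ {w} → Invariant w → ∀ v → w v ≤ p v
  invariant-bound {w} inv v = x+[1-y]≤1⇒x≤y (≡.subst (_≤ 1ℚ) singleton (inv ⁅v⁆))
    where
    ∅ ⁅v⁆ : Fin n → Bool
    ∅ _ = false
    ⁅v⁆ = updateAt ∅ v (λ _ → true)
    ∅+v : Insertion ∅ v ⁅v⁆
    ∅+v = insertion-add refl
    singleton : mass ⁅v⁆ w + escape ⁅v⁆ ≡ w v + q v
    singleton = cong₂ _+_
      (≡.trans (mass-insertion ∅+v w) (≡.trans (cong (_+ w v) (Σ.sum-replicate-zero n)) (+-identityˡ (w v))))
      (≡.trans (escape-insertion ∅+v) (≡.trans (cong (_* q v) (Π.sum-replicate-zero n)) (*-identityˡ (q v))))

upper-bound : ∀ {n} (G : Graph n) {r v d} → IsDistance G r v d →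
              ∀ {w} → Reachable G (indicator r) w → w v ≤ inv-suc d
upper-bound {n} G {r} {v} {d} dist {w} reach =
  ≡.subst (w v ≤_) (cong inv-suc (cappedDistance-distance dist))
    (invariant-bound (invariant-reachable (cong inv-suc (cappedDistance-root d)) reach) v)
  where
  open BreadthFirstSearch G r
  p : Weight n
  p x = inv-suc (cappedDistance d x)
  p-nonNeg : ∀ x → 0ℚ ≤ p x
  p-nonNeg x = <⇒≤ (inv-suc-pos (cappedDistance d x))
  p-≤1 : ∀ x → p x ≤ 1ℚ
  p-≤1 x = inv-suc-≤1 (cappedDistance d x)
  p-edge : ∀ a b → Adj G a b ≡ true → p b ≤ p a * (1ℚ + p b)
  p-edge a b Gab = inv-suc-edge (cappedDistance-edge d (≡.trans (sym G b a) Gab))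
  open ShareInvariant G p p-nonNeg p-≤1 p-edge

-- Lower bound

module _ {n} {G : Graph n} where

  OnWalk : ∀ {x y k} → Walk G x y k → Fin n → Set
  OnWalk (here {x})     z = z ≡ x
  OnWalk (step {x} _ W) z = z ≡ x ⊎ OnWalk W z

  onWalk? : ∀ {x y k} (W : Walk G x y k) z → Dec (OnWalk W z)
  onWalk? (here {x})     z = z ≟ x
  onWalk? (step {x} _ W) z = (z ≟ x) ⊎-dec onWalk? W z

  onWalk-start : ∀ {x y k} (W : Walk G x y k) → OnWalk W x
  onWalk-start here       = refl
  onWalk-start (step _ _) = inj₁ refl

  visits : ∀ {x y k} → Walk G x y k → Weight n
  visits (here {x})     = indicator x
  visits (step {x} _ W) z = indicator x z + visits W z

  visits-nonNeg : ∀ {x y k} (W : Walk G x y k) z → 0ℚ ≤ visits W z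
  visits-nonNeg (here {x})     z = indicator-nonNeg x z
  visits-nonNeg (step {x} _ W) z = 0≤+ (indicator-nonNeg x z) (visits-nonNeg W z)

  visits-onWalk : ∀ {x y k} (W : Walk G x y k) {z} → OnWalk W z → 1ℚ ≤ visits W z
  visits-onWalk (here {x})     refl        = ≤-reflexive (≡.sym (indicator-self x))
  visits-onWalk (step {x} _ W) (inj₁ refl) =
    ≡.subst (λ t → 1ℚ ≤ t + visits W x) (≡.sym (indicator-self x)) (p≤p+q (visits-nonNeg W x))
  visits-onWalk (step {x} _ W) {z} (inj₂ z∈W) =
    ≤-trans (visits-onWalk W z∈W) (p≤q+p (indicator-nonNeg x z))

  Σ-visits : ∀ {x y k} (W : Walk G x y k) → Σ.sum (visits W) ≡ suc k · 1ℚ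
  Σ-visits (here {x})     = Σ-indicator x
  Σ-visits (step {x} _ W) =
    ≡.trans (Σ.∑-distrib-+ (indicator x) (visits W)) (cong₂ _+_ (Σ-indicator x) (Σ-visits W))

  record Concentrated {x y k} (W : Walk G x y k) (w : Weight n) : Set where
    field
      nonNeg  : ∀ z → 0ℚ ≤ w z
      total   : Σ.sum w ≡ 1ℚ
      support : ∀ z → ¬ OnWalk W z → w z ≡ 0ℚ

  Flat : ∀ {x y k} → Walk G x y k → Weight n → ℚ → Set
  Flat W w M = ∀ z → OnWalk W z → w z ≤ M

  flat-total : ∀ {x y k} {W : Walk G x y k} {w M} → Concentrated W w → Flat W w M → 1ℚ ≤ suc k · M
  flat-total {x} {k = k} {W} {w} {M} conc flat = begin
    1ℚ                            ≡⟨ ≡.sym total ⟩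
    Σ.sum w                       ≤⟨ Σ-mono-≤ bounded ⟩
    Σ.sum (λ z → M * visits W z)  ≡⟨ ≡.sym (*-distribˡ-sum M (visits W)) ⟩
    M * Σ.sum (visits W)          ≡⟨ cong (M *_) (Σ-visits W) ⟩
    M * (suc k · 1ℚ)              ≡⟨ ×-comm-* (suc k) M 1ℚ ⟩
    suc k · (M * 1ℚ)              ≡⟨ cong (suc k ·_) (*-identityʳ M) ⟩
    suc k · M                     ∎
    where
    open Concentrated conc
    open ≤-Reasoning
    0≤M : 0ℚ ≤ M
    0≤M = ≤-trans (nonNeg x) (flat x (onWalk-start W))
    bounded : ∀ z → w z ≤ M * visits W z
    bounded z with onWalk? W z
    ... | yes z∈W = ≤-trans (flat z z∈W)
                      (≡.subst (_≤ M * visits W z) (*-identityʳ M) (*-monoˡ-≤-0≤ 0≤M (visits-onWalk W z∈W)))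
    ... | no  z∉W = ≡.subst (_≤ M * visits W z) (≡.sym (support z z∉W)) (0≤* 0≤M (visits-nonNeg W z))

  SteepEdge : ∀ {x y k} → Walk G x y k → Weight n → ℚ → Set
  SteepEdge W w δ = ∃₂ λ a b → Adj G a b ≡ true × OnWalk W a × OnWalk W b × δ ≤ w a - w b

  steep-or-flat : ∀ w {δ} → 0ℚ ≤ δ → ∀ {x z k} (W : Walk G x z k) →
                  SteepEdge W w δ ⊎ Flat W w (w z + k · δ)
  steep-or-flat w 0≤δ here = inj₂ λ { _ refl → ≤-reflexive (≡.sym (+-identityʳ _)) }
  steep-or-flat w {δ} 0≤δ (step {x} {y} {z} {k} Gxy W) with steep-or-flat w 0≤δ W
  ... | inj₁ (a , b , Gab , a∈W , b∈W , steep) = inj₁ (a , b , Gab , inj₂ a∈W , inj₂ b∈W , steep)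
  ... | inj₂ flat with δ ≤? w x - w y
  ...   | yes steep = inj₁ (x , y , Gxy , inj₁ refl , inj₂ (onWalk-start W) , steep)
  ...   | no  gentle =
    inj₂ λ { _ (inj₁ refl) → <⇒≤ x-bound ; v (inj₂ v∈W) → ≤-trans (flat v v∈W) weaken }
    where
    open ≤-Reasoning
    open +-*-Solver
    shift : δ + (w z + k · δ) ≡ w z + suc k · δ
    shift = solve 3 (λ d a s → d :+ (a :+ s) := a :+ (d :+ s)) refl δ (w z) (k · δ)
    weaken : w z + k · δ ≤ w z + suc k · δ
    weaken = ≡.subst (w z + k · δ ≤_) shift (p≤q+p 0≤δ)
    x-bound : w x < w z + suc k · δ
    x-bound = begin-strict
      w x                ≡⟨ solve 2 (λ a b → a := (a :- b) :+ b) refl (w x) (w y) ⟩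
      (w x - w y) + w y  <⟨ +-mono-<-≤ (≰⇒> gentle) (flat y (onWalk-start W)) ⟩
      δ + (w z + k · δ)  ≡⟨ shift ⟩
      w z + suc k · δ    ∎

  concentrated-start : ∀ {x y k} (W : Walk G x y k) → Concentrated W (indicator x)
  concentrated-start {x} W = record
    { nonNeg  = indicator-nonNeg x
    ; total   = Σ-indicator x
    ; support = λ z z∉W → indicator-other x {z} (λ { refl → z∉W (onWalk-start W) })
    }

  concentrated-share : ∀ {x y k} {W : Walk G x y k} {w a b} → Concentrated W w → Adj G a b ≡ true →
                       OnWalk W a → OnWalk W b → Concentrated W (share w a b)
  concentrated-share {W = W} {w} {a} {b} conc Gab a∈W b∈W = record
    { nonNeg  = isShare-nonNeg s nonNeg
    ; total   = ≡.trans (Σ-share (adj⇒≢ G Gab) s) total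
    ; support = λ z z∉W →
        ≡.trans (IsShare.elsewhere s z (λ { refl → z∉W a∈W }) (λ { refl → z∉W b∈W })) (support z z∉W)
    }
    where
    open Concentrated conc
    s = share-isShare w a b

energy : ∀ {n} → Weight n → ℚ
energy w = Σ.sum (λ x → w x * w x)

energy-nonNeg : ∀ {n} (w : Weight n) → 0ℚ ≤ energy w
energy-nonNeg {n} w = ≡.subst (_≤ energy w) (Σ.sum-replicate-zero n) (Σ-mono-≤ square-nonNeg)
  where
  square-nonNeg : ∀ x → 0ℚ ≤ w x * w x
  square-nonNeg x with ≤-total 0ℚ (w x)
  ... | inj₁ 0≤wx = 0≤* 0≤wx 0≤wx
  ... | inj₂ wx≤0 =
    nonNegative⁻¹ _ {{nonPos*nonPos⇒nonPos (w x) {{nonPositive wx≤0}} (w x) {{nonPositive wx≤0}}}}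

energy-indicator : ∀ {n} (r : Fin n) → energy (indicator r) ≡ 1ℚ
energy-indicator r = ≡.trans (Σ.sum-supported-at _ r off-r) at-r
  where
  off-r : ∀ x → x ≢ r → indicator r x * indicator r x ≡ 0ℚ
  off-r x x≢r rewrite indicator-other r x≢r = refl
  at-r : indicator r r * indicator r r ≡ 1ℚ
  at-r rewrite indicator-self r = refl

energy-share : ∀ {n} {w w′ : Weight n} {a b} → a ≢ b → IsShare w w′ a b →
               energy w′ + ½ * ((w a - w b) * (w a - w b)) ≡ energy w
energy-share {w = w} {w′} {a} {b} a≢b s = +-cancelʳ (m² + m²) _ _ (begin
  (energy w′ + ½ * gap²) + (m² + m²)   ≡⟨ +-assoc (energy w′) _ _ ⟩
  energy w′ + (½ * gap² + (m² + m²))   ≡⟨ cong (_+_ (energy w′)) (parallelogram (w a) (w b)) ⟩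
  energy w′ + (w a * w a + w b * w b)  ≡⟨ squares ⟩
  energy w + (m² + m²)                 ∎)
  where
  open ≡-Reasoning
  open IsShare s
  mean : ℚ → ℚ → ℚ
  mean x y = (x + y) * ½
  gap² m² : ℚ
  gap² = (w a - w b) * (w a - w b)
  m²   = mean (w a) (w b) * mean (w a) (w b)
  parallelogram : ∀ x y → ½ * ((x - y) * (x - y)) + (mean x y * mean x y + mean x y * mean x y) ≡ x * x + y * y
  parallelogram = solve 2 (λ x y →
      con ½ :* ((x :- y) :* (x :- y))
        :+ ((x :+ y) :* con ½ :* ((x :+ y) :* con ½) :+ (x :+ y) :* con ½ :* ((x :+ y) :* con ½))
    := x :* x :+ y :* y) refl
    where open +-*-Solver
  squares : energy w′ + (w a * w a + w b * w b) ≡ energy w + (m² + m²)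
  squares = ≡.trans
    (Σ.sum-cong-except₂ _ _ a≢b (λ x x≢a x≢b → cong (λ t → t * t) (elsewhere x x≢a x≢b)))
    (cong (_+_ (energy w)) (cong₂ (λ u v → u * u + v * v) at-left at-right))

energy-share-≤ : ∀ {n} {w w′ : Weight n} {a b δ} → a ≢ b → IsShare w w′ a b →
                 0ℚ ≤ δ → δ ≤ w a - w b → energy w′ + ½ * (δ * δ) ≤ energy w
energy-share-≤ {w = w} {w′} {a} {b} {δ} a≢b s 0≤δ δ≤gap = begin
  energy w′ + ½ * (δ * δ)                      ≤⟨ +-monoʳ-≤ (energy w′) (*-monoˡ-≤-0≤ 0≤½ δ²≤gap²) ⟩
  energy w′ + ½ * ((w a - w b) * (w a - w b))  ≡⟨ energy-share a≢b s ⟩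
  energy w                                     ∎
  where
  open ≤-Reasoning
  δ²≤gap² : δ * δ ≤ (w a - w b) * (w a - w b)
  δ²≤gap² = ≤-trans (*-monoˡ-≤-0≤ 0≤δ δ≤gap) (*-monoʳ-≤-0≤ (≤-trans 0≤δ δ≤gap) δ≤gap)

module Flattening {n} {G : Graph n} {x z k} (W : Walk G x z k) {δ} (0<δ : 0ℚ < δ) where

  κ : ℚ
  κ = ½ * (δ * δ)

  0<κ : 0ℚ < κ
  0<κ = positive⁻¹ κ {{pos*pos⇒pos ½ (δ * δ) {{pos*pos⇒pos δ {{positive 0<δ}} δ {{positive 0<δ}}}}}}

  out-of-fuel : ∀ {e} → 0ℚ ≤ e → e + κ ≤ 0ℚ → ⊥
  out-of-fuel {e} 0≤e e+κ≤0 = <-irrefl refl (<-≤-trans 0<κ (≤-trans (p≤q+p 0≤e) e+κ≤0))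

  burn-fuel : ∀ N {e} → e + κ ≤ suc N · κ → e ≤ N · κ
  burn-fuel N {e} e+κ≤ = begin
    e                   ≡⟨ solve 2 (λ e k → e := (e :+ k) :- k) refl e κ ⟩
    (e + κ) - κ         ≤⟨ +-monoˡ-≤ (- κ) e+κ≤ ⟩
    (κ + N · κ) - κ     ≡⟨ solve 2 (λ k t → (k :+ t) :- k := t) refl κ (N · κ) ⟩
    N · κ               ∎
    where
    open ≤-Reasoning
    open +-*-Solver

  energy-drop : ∀ {w a b} → Adj G a b ≡ true → δ ≤ w a - w b → energy (share w a b) + κ ≤ energy w
  energy-drop {w} {a} {b} Gab = energy-share-≤ (adj⇒≢ G Gab) (share-isShare w a b) (<⇒≤ 0<δ)

  flatten : ∀ N {w₀ w} → Reachable G w₀ w → Concentrated W w → energy w ≤ N · κ →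
            ∃ λ w′ → Reachable G w₀ w′ × Concentrated W w′ × Flat W w′ (w′ z + k · δ)
  flatten N {w = w} reach conc bounded with steep-or-flat w (<⇒≤ 0<δ) W
  ... | inj₂ flat = w , reach , conc , flat
  flatten zero    {w = w} reach conc bounded | inj₁ (a , b , Gab , a∈W , b∈W , steep) =
    ⊥-elim (out-of-fuel (energy-nonNeg (share w a b)) (≤-trans (energy-drop Gab steep) bounded))
  flatten (suc N) {w = w} reach conc bounded | inj₁ (a , b , Gab , a∈W , b∈W , steep) =
    flatten N (move a b Gab reach) (concentrated-share conc Gab a∈W b∈W)
      (burn-fuel N (≤-trans (energy-drop Gab steep) bounded))

lower-bound : ∀ {n} (G : Graph n) {r v d} → Walk G r v d → ∀ {ε} → 0ℚ < ε →
              ∃ λ w → Reachable G (indicator r) w × inv-suc d - ε < w v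
lower-bound G {r} {v} {d} W {ε} 0<ε = conclude (archimedean 0<κ)
  where
  δ : ℚ
  δ = ε * inv-suc d
  0<δ : 0ℚ < δ
  0<δ = positive⁻¹ δ {{pos*pos⇒pos ε {{positive 0<ε}} (inv-suc d) {{positive (inv-suc-pos d)}}}}
  open Flattening W 0<δ
  suc·δ : δ + d · δ ≡ ε
  suc·δ = begin
    suc d · (ε * inv-suc d)   ≡⟨ ≡.sym (×-comm-* (suc d) ε (inv-suc d)) ⟩
    ε * (suc d · inv-suc d)   ≡⟨ cong (ε *_) (suc·inv-suc d) ⟩
    ε * 1ℚ                    ≡⟨ *-identityʳ ε ⟩
    ε                         ∎
    where open ≡-Reasoning
  near-uniform : ∀ {x} → 1ℚ ≤ suc d · (x + d · δ) → inv-suc d - ε < x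
  near-uniform {x} 1≤ = begin-strict
    inv-suc d - ε                 ≡⟨ cong (λ t → inv-suc d - t) (≡.sym suc·δ) ⟩
    inv-suc d - (δ + d · δ)       ≤⟨ +-monoˡ-≤ (- (δ + d · δ)) (inv-suc-≤ d {x + d · δ} 1≤) ⟩
    (x + d · δ) - (δ + d · δ)     ≡⟨ solve 3 (λ x s t → (x :+ t) :- (s :+ t) := x :- s) refl x δ (d · δ) ⟩
    x - δ                         <⟨ +-monoʳ-< x (neg-antimono-< 0<δ) ⟩
    x + 0ℚ                        ≡⟨ +-identityʳ x ⟩
    x                             ∎
    where
    open ≤-Reasoning
    open +-*-Solver
  conclude : (∃ λ N → 1ℚ ≤ N · κ) → ∃ λ w → Reachable G (indicator r) w × inv-suc d - ε < w v
  conclude (N , 1≤Nκ)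
    with flatten N start (concentrated-start W) (≡.subst (_≤ N · κ) (≡.sym (energy-indicator r)) 1≤Nκ)
  ... | w , reach , conc , flat = w , reach , near-uniform (flat-total conc flat)

corollary3p6 : ∀ {n} (G : Graph n) → Connected G → (r v : Fin n) (d : ℕ) → IsDistance G r v d →
    (∀ w' → Reachable G (indicator r) w' → w' v ≤ inv-suc d)
    × (∀ (ε : ℚ) → 0ℚ < ε → ∃ λ w' → Reachable G (indicator r) w' × (inv-suc d - ε) < w' v)
corollary3p6 G _ r v d dist =
  (λ w reach → upper-bound G dist reach) , (λ ε 0<ε → lower-bound G (proj₁ dist) 0<ε)
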